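{- For any connected graphs $G$ and $H$, $pd(G\odot H)\ge pd(H)$.
   Context: For a connected graph $F$ and an ordered partition $\Pi=\{P_1,\dots,P_t\}$ of $V(F)$, $r(v|\Pi)=(d(v,P_1),\dots,d(v,P_t))$ where $d$ is shortest-path distance and $d(v,P_i)=\min_{u\in P_i}d(v,u)$; $\Pi$ is a resolving partition if $r(u|\Pi)\ne r(v|\Pi)$ for all distinct vertices $u,v$; $pd(F)$ is the minimum number of sets in a resolving partition. For graphs $G$ of order $n_1$ (vertices $v_1,\dots,v_{n_1}$) and $H$, the corona product $G\odot H$ is obtained from one copy of $G$ and $n_1$ copies $H_1,\dots,H_{n_1}$ of $H$ by joining $v_i$ to every vertex of $H_i$. -}

module Defs where

open import Data.Nat using (ℕ; zero; suc; _+_; _*_; _≤_; _<_)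
open import Data.Fin using (Fin; splitAt; remQuot)
open import Data.Fin.Properties using (_≟_)
open import Data.Bool using (Bool; true; false; _∧_)
open import Data.Sum using (_⊎_; inj₁; inj₂)
open import Data.Product using (_×_; _,_; ∃; ∃-syntax)
open import Relation.Nullary using (¬_)
open import Relation.Nullary.Decidable using (⌊_⌋)
open import Relation.Binary.PropositionalEquality using (_≡_; _≢_)

record Graph : Set where
  constructor mkGraph
  field
    order : ℕ
    adj   : Fin order → Fin order → Bool
open Graph public

Edge : (F : Graph) → Fin (order F) → Fin (order F) → Set
Edge F u v = adj F u v ≡ true

Simple : Graph → Set
Simple F = (∀ u v → Edge F u v → Edge F v u) × (∀ u → ¬ Edge F u u)

data Walk (F : Graph) : Fin (order F) → Fin (order F) → ℕ → Set where
  here : ∀ {u} → Walk F u u zero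
  step : ∀ {u w v k} → Edge F u w → Walk F w v k → Walk F u v (suc k)

Connected : Graph → Set
Connected F = (0 < order F) × (∀ u v → ∃[ k ] Walk F u v k)

IsDist : (F : Graph) → Fin (order F) → Fin (order F) → ℕ → Set
IsDist F u v k = Walk F u v k × (∀ m → Walk F u v m → k ≤ m)

-- An ordered partition of V(F) into t (nonempty) classes P_1..P_t,
-- given by the class-assignment map; P_i = { u | Π u ≡ i }.
IsPartition : (F : Graph) (t : ℕ) → (Fin (order F) → Fin t) → Set
IsPartition F t Π = ∀ i → ∃[ u ] Π u ≡ i

IsSetDist : (F : Graph) {t : ℕ} → (Fin (order F) → Fin t) →
            Fin (order F) → Fin t → ℕ → Set
IsSetDist F Π v i k =
  (∃[ u ] (Π u ≡ i × IsDist F v u k)) ×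
  (∀ u m → Π u ≡ i → IsDist F v u m → k ≤ m)

SameRep : (F : Graph) {t : ℕ} → (Fin (order F) → Fin t) →
          Fin (order F) → Fin (order F) → Set
SameRep F {t} Π u v =
  ∀ (i : Fin t) k l → IsSetDist F Π u i k → IsSetDist F Π v i l → k ≡ l

IsResolvingPartition : (F : Graph) (t : ℕ) → (Fin (order F) → Fin t) → Set
IsResolvingPartition F t Π =
  IsPartition F t Π × (∀ u v → u ≢ v → ¬ SameRep F Π u v)

IsPartitionDimension : Graph → ℕ → Set
IsPartitionDimension F p =
  (∃[ Π ] IsResolvingPartition F p Π) ×
  (∀ t Π → IsResolvingPartition F t Π → p ≤ t)

-- Corona product G ⊙ H. Vertices: Fin (n₁ + n₁ * n₂); the first n₁ are
-- v_1..v_{n₁} of G, and the vertex (i , x) of the second block is x in H_i.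
CoronaVertex : ℕ → ℕ → Set
CoronaVertex n₁ n₂ = Fin n₁ ⊎ (Fin n₁ × Fin n₂)

classify : (n₁ n₂ : ℕ) → Fin (n₁ + n₁ * n₂) → CoronaVertex n₁ n₂
classify n₁ n₂ v with splitAt n₁ v
... | inj₁ a = inj₁ a
... | inj₂ b = inj₂ (remQuot {n₁} n₂ b)

coronaAdj : (G H : Graph) → CoronaVertex (order G) (order H) →
            CoronaVertex (order G) (order H) → Bool
coronaAdj G H (inj₁ a)       (inj₁ b)       = adj G a b
coronaAdj G H (inj₁ a)       (inj₂ (i , x)) = ⌊ a ≟ i ⌋
coronaAdj G H (inj₂ (i , x)) (inj₁ a)       = ⌊ i ≟ a ⌋
coronaAdj G H (inj₂ (i , x)) (inj₂ (j , y)) = ⌊ i ≟ j ⌋ ∧ adj H x y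

corona : Graph → Graph → Graph
corona G H = mkGraph (order G + order G * order H)
  (λ u v → coronaAdj G H (classify (order G) (order H) u)
                         (classify (order G) (order H) v))

module Submission where

-- Fix a vertex v_i of G and a resolving partition Π of G ⊙ H with p classes.
-- Restricting Π to the copy H_i gives a labelling g of V(H) by p labels.
-- Inside G ⊙ H, every vertex of H_i reaches the rest of the graph only
-- through the hub v_i, at distance one; and a vertex of H_i is at distance
-- at most two from every other vertex of H_i.  Hence if x and y have the
-- same representation under g in H, then their copies have the same
-- representation under Π in G ⊙ H, so they coincide: g resolves H.
-- After discarding the unused labels, g becomes a resolving partition of H
-- with at most p classes, whence pd(H) ≤ p.

open import Defs
open import Data.Nat using (ℕ; zero; suc; _*_; _≤_; _<_; z≤n; s≤s)
open import Data.Nat.Properties using (≤-refl; ≤-trans; ≤-antisym; ≮⇒≥; m≤n⇒m≤1+n; anyUpTo?)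
open import Data.Nat.Induction using (<-rec)
open import Data.Fin using (Fin; splitAt; combine; _↑ˡ_; _↑ʳ_; punchIn; punchOut; fromℕ<)
open import Data.Fin.Properties
  using (_≟_; any?; all?; ¬∀⟶∃¬; punchIn-punchOut; punchIn-injective;
         splitAt-↑ˡ; splitAt-↑ʳ; splitAt⁻¹-↑ˡ; splitAt⁻¹-↑ʳ; remQuot-combine; combine-remQuot)
open import Data.Bool using (true; _∧_)
open import Data.Bool.Properties using (T-≡; ∧-conicalˡ; ∧-conicalʳ) renaming (_≟_ to _≟ᵇ_)
open import Data.Sum using (_⊎_; inj₁; inj₂)
open import Data.Product using (_×_; _,_; ∃-syntax; proj₁; proj₂)
open import Data.Empty using (⊥-elim)
open import Function using (_∘_)
open import Function.Bundles using (Equivalence)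
open import Function.Definitions using (Injective)
open import Relation.Nullary using (¬_; Dec; yes; no)
open import Relation.Nullary.Decidable using (⌊_⌋; map′; _×-dec_; toWitness; dec-true; isYes≗does)
open import Relation.Unary using (Decidable)
open import Relation.Binary.PropositionalEquality using (_≡_; _≢_; refl; sym; trans; cong; subst)

LeastWitness : (ℕ → Set) → Set
LeastWitness Q = ∃[ k ] (Q k × (∀ m → Q m → k ≤ m))

leastWitness : {Q : ℕ → Set} → Decidable Q → ∀ n → Q n → LeastWitness Q
leastWitness {Q} Q? = <-rec (λ n → Q n → LeastWitness Q) search
  where
    search : ∀ n → (∀ {m} → m < n → Q m → LeastWitness Q) → Q n → LeastWitness Q
    search n below qn with anyUpTo? Q? n
    ... | yes (m , m<n , qm) = below m<n qm
    ... | no none = n , qn , λ m qm → ≮⇒≥ (λ m<n → none (m , m<n , qm))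

-- Reach F Π v c k: some vertex of class c is joined to v by a walk of
-- length at most k.  Set distances are the least such k.
Reach : (F : Graph) {t : ℕ} → (Fin (order F) → Fin t) → Fin (order F) → Fin t → ℕ → Set
Reach F Π v c k = ∃[ u ] ∃[ m ] (Π u ≡ c × m ≤ k × Walk F v u m)

reach-mono : ∀ {F : Graph} {t} {Π : Fin (order F) → Fin t} {v c l k} →
             l ≤ k → Reach F Π v c l → Reach F Π v c k
reach-mono l≤k (u , m , pu , m≤l , w) = u , m , pu , ≤-trans m≤l l≤k , w

walk-length0 : ∀ {F : Graph} {a b} → Walk F a b 0 → a ≡ b
walk-length0 here = refl

walk-length1 : ∀ {F : Graph} {a b} → Walk F a b 1 → Edge F a b
walk-length1 (step e here) = e

module Distances (F : Graph) where
  private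
    V : Set
    V = Fin (order F)

  walk? : ∀ x v k → Dec (Walk F x v k)
  walk? x v zero = map′ (λ { refl → here }) walk-length0 (x ≟ v)
  walk? x v (suc k) =
    map′ (λ (w , e , p) → step e p) (λ { (step e p) → _ , e , p })
         (any? (λ w → (adj F x w ≟ᵇ true) ×-dec walk? w v k))

  WalkInto : (V → Set) → V → ℕ → Set
  WalkInto P x k = ∃[ u ] (P u × Walk F x u k)

  shortestWalkInto : {P : V → Set} → Decidable P → ∀ {x k} → WalkInto P x k →
                     LeastWitness (WalkInto P x)
  shortestWalkInto P? {x} {k} =
    leastWitness (λ m → any? (λ u → P? u ×-dec walk? x u m)) k

  distExists : ∀ {x u m} → Walk F x u m → ∃[ d ] IsDist F x u d
  distExists {u = u} w with shortestWalkInto (_≟ u) (u , refl , w)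
  ... | d , (_ , refl , wd) , shortest = d , wd , λ m w′ → shortest m (u , refl , w′)

  module _ {t : ℕ} (Π : V → Fin t) where
    setDistExists : ∀ {v c k} → Reach F Π v c k → ∃[ l ] IsSetDist F Π v c l
    setDistExists {c = c} (u , _ , pu , _ , w) with shortestWalkInto (λ u → Π u ≟ c) (u , pu , w)
    ... | l , (u′ , pu′ , wl) , shortest =
      l , (u′ , pu′ , wl , λ m w′ → shortest m (u′ , pu′ , w′)) ,
          λ u″ m pu″ dist → shortest m (u″ , pu″ , proj₁ dist)

    setDist-reach : ∀ {v c l} → IsSetDist F Π v c l → Reach F Π v c l
    setDist-reach ((u , pu , w , _) , _) = u , _ , pu , ≤-refl , w

    setDist-≤ : ∀ {v c l k} → IsSetDist F Π v c l → Reach F Π v c k → l ≤ k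
    setDist-≤ (_ , least) (u , m , pu , m≤k , w) with distExists w
    ... | d , wd , shortest = ≤-trans (least u d pu (wd , shortest)) (≤-trans (shortest m w) m≤k)

    sameRep-reach : (∀ u v → ∃[ k ] Walk F u v k) → ∀ {x y c k} →
                    SameRep F Π x y → Reach F Π x c k → Reach F Π y c k
    sameRep-reach conn {y = y} {c} sr rx@(u , _ , pu , _ , _)
      with setDistExists rx | setDistExists (u , _ , pu , ≤-refl , proj₂ (conn y u))
    ... | l , dx | l′ , dy with sr c l l′ dx dy
    ... | refl = reach-mono (setDist-≤ dx rx) (setDist-reach dy)

    sameRep-sym : ∀ {x y} → SameRep F Π x y → SameRep F Π y x
    sameRep-sym sr c k l dy dx = sym (sr c l k dx dy)

    sameRep-fromReach : ∀ {x y} →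
                        (∀ {c k} → Reach F Π x c k → Reach F Π y c k) →
                        (∀ {c k} → Reach F Π y c k → Reach F Π x c k) →
                        SameRep F Π x y
    sameRep-fromReach x⇒y y⇒x c k l dx dy =
      ≤-antisym (setDist-≤ dx (y⇒x (setDist-reach dy))) (setDist-≤ dy (x⇒y (setDist-reach dx)))

-- A labelling resolves F when distinct vertices have distinct
-- representations; unlike a resolving partition, labels may be unused.
Resolving : (F : Graph) {t : ℕ} → (Fin (order F) → Fin t) → Set
Resolving F Π = ∀ u v → u ≢ v → ¬ SameRep F Π u v

module Relabelling (F : Graph) where
  private
    V : Set
    V = Fin (order F)

  record Factorisation {p t : ℕ} (g : V → Fin p) (g′ : V → Fin t) : Set where
    field
      ρ : Fin t → Fin p
      ρ-injective : Injective _≡_ _≡_ ρ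
      factor : ∀ x → g x ≡ ρ (g′ x)

  module _ {p t : ℕ} {g : V → Fin p} {g′ : V → Fin t} (f : Factorisation g g′) where
    open Factorisation f

    setDist-unrename : ∀ {v j k} → IsSetDist F g v (ρ j) k → IsSetDist F g′ v j k
    setDist-unrename ((u , pu , d) , least) =
      (u , ρ-injective (trans (sym (factor u)) pu) , d) ,
      λ u′ m pu′ d′ → least u′ m (trans (factor u′) (cong ρ pu′)) d′

    sameRep-rename : ∀ {x y} → SameRep F g′ x y → SameRep F g x y
    sameRep-rename sr c k l dx@((u , pu , _) , _) dy =
      sr (g′ u) k l (setDist-unrename (subst (λ c → IsSetDist F g _ c k) eq dx))
                    (setDist-unrename (subst (λ c → IsSetDist F g _ c l) eq dy))
      where
        eq : c ≡ ρ (g′ u)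
        eq = trans (sym pu) (factor u)

    resolving-unrename : Resolving F g → Resolving F g′
    resolving-unrename res x y x≢y sr = res x y x≢y (sameRep-rename sr)

  identityFactorisation : ∀ {p} {g : V → Fin p} → Factorisation g g
  identityFactorisation = record { ρ = λ j → j ; ρ-injective = λ e → e ; factor = λ _ → refl }

  -- Every labelling with p labels factors through a surjective one with
  -- t ≤ p labels: remove unused labels one at a time.
  record Compaction {p : ℕ} (g : V → Fin p) : Set where
    field
      t : ℕ
      t≤p : t ≤ p
      g′ : V → Fin t
      surjective : ∀ j → ∃[ u ] g′ u ≡ j
      factorisation : Factorisation g g′

  compaction : ∀ {p} (g : V → Fin p) → Compaction g
  compaction {zero} g = record
    { t = 0 ; t≤p = z≤n ; g′ = g ; surjective = λ ()
    ; factorisation = identityFactorisation }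
  compaction {suc p} g with all? (λ j → any? (λ u → g u ≟ j))
  ... | yes surj = record
    { t = suc p ; t≤p = ≤-refl ; g′ = g ; surjective = surj
    ; factorisation = identityFactorisation }
  ... | no ¬surj with ¬∀⟶∃¬ _ _ (λ j → any? (λ u → g u ≟ j)) ¬surj
  ... | j , unused = record
    { t = t ; t≤p = m≤n⇒m≤1+n t≤p ; g′ = g′ ; surjective = surjective
    ; factorisation = record
      { ρ = punchIn j ∘ ρ
      ; ρ-injective = ρ-injective ∘ punchIn-injective j _ _
      ; factor = λ x → trans (sym (punchIn-punchOut (avoids x))) (cong (punchIn j) (factor x)) } }
    where
      avoids : ∀ x → j ≢ g x
      avoids x e = unused (x , sym e)
      open Compaction (compaction (λ x → punchOut (avoids x)))
      open Factorisation factorisation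

  pd-≤-labels : ∀ {p q} → IsPartitionDimension F q →
                (g : V → Fin p) → Resolving F g → q ≤ p
  pd-≤-labels (_ , minimal) g res =
    ≤-trans (minimal t g′ (surjective , resolving-unrename factorisation res)) t≤p
    where open Compaction (compaction g)

module CoronaVertices (n₁ n₂ : ℕ) where
  classify-inj₁ : ∀ a → classify n₁ n₂ (a ↑ˡ (n₁ * n₂)) ≡ inj₁ a
  classify-inj₁ a rewrite splitAt-↑ˡ n₁ a (n₁ * n₂) = refl

  classify-inj₂ : ∀ j z → classify n₁ n₂ (n₁ ↑ʳ combine j z) ≡ inj₂ (j , z)
  classify-inj₂ j z rewrite splitAt-↑ʳ n₁ (n₁ * n₂) (combine j z) | remQuot-combine {n₁} {n₂} j z = refl

  classify⁻¹-inj₁ : ∀ {v a} → classify n₁ n₂ v ≡ inj₁ a → v ≡ a ↑ˡ (n₁ * n₂)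
  classify⁻¹-inj₁ {v} eq with splitAt n₁ v in sp
  classify⁻¹-inj₁ refl | inj₁ _ = sym (splitAt⁻¹-↑ˡ sp)

  classify⁻¹-inj₂ : ∀ {v j z} → classify n₁ n₂ v ≡ inj₂ (j , z) → v ≡ n₁ ↑ʳ combine j z
  classify⁻¹-inj₂ {v} eq with splitAt n₁ v in sp
  classify⁻¹-inj₂ refl | inj₂ b =
    trans (sym (splitAt⁻¹-↑ʳ sp)) (cong (n₁ ↑ʳ_) (sym (combine-remQuot {n₁} n₂ b)))

≟-true : ∀ {n} {i j : Fin n} → ⌊ i ≟ j ⌋ ≡ true → i ≡ j
≟-true e = toWitness (Equivalence.from T-≡ e)

≟-diag : ∀ {n} (i : Fin n) → ⌊ i ≟ i ⌋ ≡ true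
≟-diag i = trans (isYes≗does (i ≟ i)) (dec-true (i ≟ i) refl)

module CoronaCopy (G H : Graph) (i : Fin (order G)) where
  open CoronaVertices (order G) (order H)

  private
    C : Graph
    C = corona G H

    cl : Fin (order C) → CoronaVertex (order G) (order H)
    cl = classify (order G) (order H)

  copy : Fin (order H) → Fin (order C)
  copy z = order G ↑ʳ combine i z

  hub : Fin (order C)
  hub = i ↑ˡ (order G * order H)

  edge-decode : ∀ {u w cu cw} → cl u ≡ cu → cl w ≡ cw → Edge C u w → coronaAdj G H cu cw ≡ true
  edge-decode refl refl e = e

  edge-encode : ∀ {u w cu cw} → cl u ≡ cu → cl w ≡ cw → coronaAdj G H cu cw ≡ true → Edge C u w
  edge-encode refl refl e = e

  copy-injective : ∀ {a b} → copy a ≡ copy b → a ≡ b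
  copy-injective {a} {b} e with trans (sym (classify-inj₂ i a)) (trans (cong cl e) (classify-inj₂ i b))
  ... | refl = refl

  copy→hub : ∀ z → Edge C (copy z) hub
  copy→hub z = edge-encode (classify-inj₂ i z) (classify-inj₁ i) (≟-diag i)

  hub→copy : ∀ z → Edge C hub (copy z)
  hub→copy z = edge-encode (classify-inj₁ i) (classify-inj₂ i z) (≟-diag i)

  liftEdge : ∀ {a b} → Edge H a b → Edge C (copy a) (copy b)
  liftEdge {a} {b} e = edge-encode (classify-inj₂ i a) (classify-inj₂ i b)
    (subst (λ s → (s ∧ adj H a b) ≡ true) (sym (≟-diag i)) e)

  lowerEdge : ∀ {a b} → Edge C (copy a) (copy b) → Edge H a b
  lowerEdge {a} {b} e = ∧-conicalʳ _ _ (edge-decode (classify-inj₂ i a) (classify-inj₂ i b) e)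

  liftWalk : ∀ {a b m} → Walk H a b m → Walk C (copy a) (copy b) m
  liftWalk here = here
  liftWalk (step e w) = step (liftEdge e) (liftWalk w)

  copyNeighbour : ∀ {x w} → Edge C (copy x) w → w ≡ hub ⊎ ∃[ z ] w ≡ copy z
  copyNeighbour {x} {w} e = neighbour (cl w) refl (edge-decode (classify-inj₂ i x) refl e)
    where
      neighbour : ∀ cw → cl w ≡ cw → coronaAdj G H (inj₂ (i , x)) cw ≡ true →
                  w ≡ hub ⊎ ∃[ z ] w ≡ copy z
      neighbour (inj₁ a) eq a-adj with ≟-true {i = i} {j = a} a-adj
      ... | refl = inj₁ (classify⁻¹-inj₁ eq)
      neighbour (inj₂ (j , z)) eq z-adj with ≟-true {i = i} {j = j} (∧-conicalˡ _ _ z-adj)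
      ... | refl = inj₂ (z , classify⁻¹-inj₂ eq)

  Outside : Fin (order C) → Set
  Outside u = ∀ z → u ≢ copy z

  copyView : ∀ u → (∃[ z ] u ≡ copy z) ⊎ Outside u
  copyView u with any? (λ z → u ≟ copy z)
  ... | yes inside = inj₁ inside
  ... | no outside = inj₂ (λ z e → outside (z , e))

  -- Every walk leaving H_i passes through the hub, so it can be shortened
  -- to a walk from the hub.
  exitThroughHub : ∀ {x u k} → Walk C (copy x) u k → Outside u →
                   ∃[ m ] (m < k × Walk C hub u m)
  exitThroughHub {x} here out = ⊥-elim (out x refl)
  exitThroughHub (step e w) out with copyNeighbour e
  ... | inj₁ refl = _ , ≤-refl , w
  ... | inj₂ (_ , refl) with exitThroughHub w out
  ...   | m , m<k , w′ = m , m≤n⇒m≤1+n m<k , w′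

  module Restriction (connH : ∀ u v → ∃[ k ] Walk H u v k) {p : ℕ} (Π : Fin (order C) → Fin p) where
    open Distances

    restrict : Fin (order H) → Fin p
    restrict z = Π (copy z)

    liftReach : ∀ {x c k} → Reach H restrict x c k → Reach C Π (copy x) c k
    liftReach (z , m , pz , m≤k , w) = copy z , m , pz , m≤k , liftWalk w

    -- What the copy of x reaches within k steps, the copy of a twin y reaches
    -- too: outside H_i via the hub, inside H_i within two steps, or within
    -- zero or one step by a walk of H itself.
    copyReach : ∀ {x y c k} → SameRep H restrict x y →
                Reach C Π (copy x) c k → Reach C Π (copy y) c k
    copyReach {y = y} sr (u , m , pu , m≤k , w) with copyView u
    ... | inj₂ out with exitThroughHub w out
    ...   | m′ , m′<m , w′ = u , suc m′ , pu , ≤-trans m′<m m≤k , step (copy→hub y) w′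
    copyReach {x} sr (_ , zero , pu , _ , w) | inj₁ (z , refl) with copy-injective (walk-length0 w)
    ... | refl = liftReach (sameRep-reach H restrict connH sr (x , 0 , pu , z≤n , here))
    copyReach sr (_ , suc zero , pu , m≤k , w) | inj₁ (z , refl) =
      liftReach (sameRep-reach H restrict connH sr (z , 1 , pu , m≤k , step (lowerEdge (walk-length1 w)) here))
    copyReach {y = y} sr (_ , suc (suc _) , pu , s≤s (s≤s _) , _) | inj₁ (z , refl) =
      copy z , 2 , pu , s≤s (s≤s z≤n) , step (copy→hub y) (step (hub→copy z) here)

    sameRep-lift : ∀ {x y} → SameRep H restrict x y → SameRep C Π (copy x) (copy y)
    sameRep-lift sr = sameRep-fromReach C Π (copyReach sr) (copyReach (sameRep-sym H restrict sr))

    restriction-resolves : Resolving C Π → Resolving H restrict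
    restriction-resolves res x y x≢y sr = res (copy x) (copy y) (x≢y ∘ copy-injective) (sameRep-lift sr)

corollary8 : (G H : Graph) → Simple G → Simple H → Connected G → Connected H →
    (p q : ℕ) → IsPartitionDimension (corona G H) p → IsPartitionDimension H q →
    q ≤ p
corollary8 G H _ _ (0<|G| , _) (_ , connH) p q ((Π , _ , resolves) , _) pdH =
  pd-≤-labels pdH restrict (restriction-resolves resolves)
  where
    open Relabelling H
    open CoronaCopy G H (fromℕ< 0<|G|)
    open Restriction connH Π
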